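{- Let $\Gamma$ be a finite simple graph with a Godsil--McKay partition $\pi=\{C_1,\dots,C_t,D\}$ with Godsil--McKay cell $D$, and let $\Delta$ be a finite simple graph. For $w\in V(\Delta)$ set $C_i^{(w)}=C_i\times\{w\}$, set $\mathcal{D}=D\times V(\Delta)$, and let $\Pi=\{C_i^{(w)}\mid i\in[t],\ w\in V(\Delta)\}\sqcup\{\mathcal{D}\}$. Then, for the product $\star$ of any type $[0s_{01}s_{02};s_{10}s_{11}s_{12};s_{20}s_{21}s_{22}]$ with $s_{ij}\in\{0,1\}$, $\Pi$ is a Godsil--McKay partition of $\Gamma\star\Delta$ with Godsil--McKay cell $\mathcal{D}$. Moreover, $(\mathrm{sw}_{\pi}\Gamma)\star\Delta$ is isomorphic to $\mathrm{sw}_{\Pi}(\Gamma\star\Delta)$.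
   Context: A partition $\{C_1,\dots,C_t\}$ of a vertex set is equitable if for all $i,j$ any two vertices of $C_i$ have the same number of neighbours in $C_j$. A partition $\pi=\{C_1,\dots,C_t,D\}$ of $V(\Gamma)$ is a Godsil--McKay partition with Godsil--McKay cell $D$ if (i) $\{C_1,\dots,C_t\}$ is an equitable partition of the induced subgraph on $V(\Gamma)\setminus D$, and (ii) for every $x\in D$ and every $i\in[t]$, $x$ has either $0$, $\tfrac12|C_i|$ or $|C_i|$ neighbours in $C_i$. The switched graph $\mathrm{sw}_\pi\Gamma$ (Godsil--McKay switching) is obtained from $\Gamma$ by interchanging adjacency and nonadjacency between $x\in D$ and the vertices of $C_i$ whenever $x$ has exactly $\tfrac12|C_i|$ neighbours in $C_i$. Graph products of a given type: for graphs $\Gamma,\Delta$ set $A_0=I_{|V(\Gamma)|}$, $A_1=A(\Gamma)$, $A_2=J-I-A(\Gamma)$, $B_0=I_{|V(\Delta)|}$, $B_1=A(\Delta)$, $B_2=J-I-A(\Delta)$, where $A(\cdot)$ is the adjacency matrix, $J$ the all-ones matrix and $I$ the identity. Given $s_{ij}\in\{0,1\}$ with $s_{00}=0$, $\Gamma\star\Delta$ is the simple graph on $V(\Gamma)\times V(\Delta)$ with adjacency matrix $\sum_{i,j\in\{0,1,2\}}s_{ij}(A_i\otimes B_j)$; the sequence $[0s_{01}s_{02};s_{10}s_{11}s_{12};s_{20}s_{21}s_{22}]$ is its type. -}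

module Defs where

open import Data.Nat using (ℕ; zero; suc; _+_; _*_; _≡ᵇ_)
open import Data.Bool using (Bool; true; false; if_then_else_; not; _∧_; _∨_)
open import Data.Fin using (Fin; zero; suc; combine; remQuot; _≟_)
open import Data.Maybe using (Maybe; just; nothing)
open import Data.Product using (_×_; _,_; Σ)
open import Data.Sum using (_⊎_)
open import Relation.Nullary.Decidable using (⌊_⌋; yes; no)
open import Relation.Binary.PropositionalEquality using (_≡_)
open import Function.Bundles using (_↔_; Inverse)

Adj : ℕ → Set
Adj n = Fin n → Fin n → Bool

record IsSimple {n : ℕ} (A : Adj n) : Set where
  field
    symmetric  : ∀ x y → A x y ≡ A y x
    irreflexive : ∀ x → A x x ≡ false

count : ∀ {n} → (Fin n → Bool) → ℕ
count {zero}  p = 0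
count {suc n} p = (if p zero then 1 else 0) + count (λ k → p (suc k))

-- A partition {C_1,…,C_t,D} of Fin n is given by a labelling
-- c : Fin n → Maybe (Fin t); c x ≡ just i means x ∈ C_(i+1), c x ≡ nothing means x ∈ D.
Labelling : ℕ → ℕ → Set
Labelling n t = Fin n → Maybe (Fin t)

inCell : ∀ {n t} → Labelling n t → Fin t → Fin n → Bool
inCell c i x with c x
... | just j  = ⌊ j ≟ i ⌋
... | nothing = false

cellSize : ∀ {n t} → Labelling n t → Fin t → ℕ
cellSize c i = count (inCell c i)

nbrs : ∀ {n t} → Adj n → Labelling n t → Fin n → Fin t → ℕ
nbrs A c x i = count (λ y → inCell c i y ∧ A x y)

record IsGMPartition {n t : ℕ} (A : Adj n) (c : Labelling n t) : Set where
  field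
    equitable : ∀ (i j : Fin t) (x y : Fin n) → c x ≡ just i → c y ≡ just i →
                nbrs A c x j ≡ nbrs A c y j
    gmCell : ∀ (x : Fin n) → c x ≡ nothing → ∀ (i : Fin t) →
             (nbrs A c x i ≡ 0) ⊎ ((2 * nbrs A c x i ≡ cellSize c i) ⊎ (nbrs A c x i ≡ cellSize c i))

halfPair : ∀ {n t} → Adj n → Labelling n t → Fin n → Fin n → Bool
halfPair A c x y with c x | c y
... | nothing | just i = (2 * nbrs A c x i) ≡ᵇ cellSize c i
... | _       | _      = false

switch : ∀ {n t} → Adj n → Labelling n t → Adj n
switch A c x y =
  if halfPair A c x y ∨ halfPair A c y x then not (A x y) else A x y

-- index i ∈ {0,1,2} with (A_i)_{xy} = 1, where A_0 = I, A_1 = A, A_2 = J - I - A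
relIndex : ∀ {n} → Adj n → Fin n → Fin n → Fin 3
relIndex A x y with x ≟ y
... | yes _ = zero
... | no  _ = if A x y then suc zero else suc (suc zero)

ProductType : Set
ProductType = Fin 3 → Fin 3 → Bool

-- Γ ⋆ Δ on V(Γ) × V(Δ), identified with Fin (n * m) via combine / remQuot;
-- adjacency matrix Σ s_ij (A_i ⊗ B_j)
product : ∀ {n m} → ProductType → Adj n → Adj m → Adj (n * m)
product {n} {m} s A B v v' with remQuot {n} m v | remQuot {n} m v'
... | (a , b) | (a' , b') = s (relIndex A a a') (relIndex B b b')

-- Π = {C_i × {w}} ⊔ {D × V(Δ)}, cell C_i × {w} labelled by combine i w
liftLabelling : ∀ {n t} (m : ℕ) → Labelling n t → Labelling (n * m) (t * m)
liftLabelling {n} m c v with remQuot {n} m v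
... | (a , w) with c a
...   | just i  = just (combine i w)
...   | nothing = nothing

Isomorphic : ∀ {N} → Adj N → Adj N → Set
Isomorphic {N} A B = Σ (Fin N ↔ Fin N) (λ f → ∀ x y → A x y ≡ B (Inverse.to f x) (Inverse.to f y))

-- A vertex (x, w) of Γ ⋆ Δ sees the cell C_j × {w'} exactly as x sees C_j, weighted by the
-- Δ-relation ρ of w and w': it has s₀ρ [x ∈ C_j] + s₁ρ K + s₂ρ R neighbours there, where K and R
-- are the numbers of neighbours and non-neighbours of x in C_j. On a cell of π these three numbers
-- are constant by equitability, and for x ∈ D the pair (K, R) is (0, |C_j|), (|C_j|/2, |C_j|/2) or
-- (|C_j|, 0), a shape any such weighting preserves. The weighted count is half of |C_j| exactly when
-- K is and s₁ρ ≠ s₂ρ, which is exactly when switching x against C_j changes the product adjacency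
-- s(Γ-relation, ρ); so the identity map is the isomorphism.
module Submission where

open import Defs
open import Data.Bool using (Bool; true; false; if_then_else_; not; _∧_; _∨_; _xor_)
open import Data.Bool.Properties using (∧-assoc; ∧-comm; ∧-identityʳ; ∧-zeroʳ; ∧-distribʳ-∨)
open import Data.Empty using (⊥-elim)
open import Data.Fin using (Fin; zero; suc; combine; remQuot; quotRem; _≟_; _↑ˡ_; _↑ʳ_)
open import Data.Fin.Patterns using (0F; 1F; 2F)
open import Data.Fin.Properties
  using (remQuot-combine; combine-remQuot; combine-injectiveˡ; combine-injectiveʳ)
open import Data.Maybe using (just; nothing)
import Data.Maybe as Maybe
open import Data.Maybe.Properties using (just-injective)
open import Data.Nat using (ℕ; zero; suc; _+_; _*_; _≡ᵇ_; _<_; s≤s; z≤n)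
import Data.Nat as ℕ
open import Data.Nat.Properties
  using (+-assoc; +-identityʳ; +-cancelˡ-≡; ≤-trans; m≤n+m; m<m+n; *-monoʳ-<; <⇒≢; +-0-commutativeMonoid)
open import Algebra.Properties.CommutativeMonoid.Sum +-0-commutativeMonoid
  using (sum-syntax; ∑-distrib-+; sum-cong-≗; sum-replicate-zero)
open import Data.Product using (Σ; _×_; _,_; proj₁; proj₂; swap)
open import Data.Sum using (_⊎_; inj₁; inj₂)
open import Function using (_∘_)
open import Function.Construct.Identity using (↔-id)
open import Relation.Nullary using (¬_; yes; no)
open import Relation.Nullary.Decidable using (Dec; ⌊_⌋; dec-true; dec-false; isYes≗does; ⌊⌋-map′)
open import Relation.Binary.PropositionalEquality

keepIf : Bool → ℕ → ℕ
keepIf b k = if b then k else 0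

keepIf-0 : ∀ b → keepIf b 0 ≡ 0
keepIf-0 true  = refl
keepIf-0 false = refl

keepIf-+ : ∀ b x y → keepIf b (x + y) ≡ keepIf b x + keepIf b y
keepIf-+ true  x y = refl
keepIf-+ false x y = refl

keepIf-∧ : ∀ b d → keepIf b (keepIf d 1) ≡ keepIf (d ∧ b) 1
keepIf-∧ b true  = refl
keepIf-∧ b false = keepIf-0 b

⌊⌋-yes : ∀ {A : Set} (a? : Dec A) → A → ⌊ a? ⌋ ≡ true
⌊⌋-yes a? a = trans (isYes≗does a?) (dec-true a? a)

⌊⌋-no : ∀ {A : Set} (a? : Dec A) → ¬ A → ⌊ a? ⌋ ≡ false
⌊⌋-no a? ¬a = trans (isYes≗does a?) (dec-false a? ¬a)

≡ᵇ-refl : ∀ k → (k ≡ᵇ k) ≡ true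
≡ᵇ-refl k = dec-true (k ℕ.≟ k) refl

<⇒≡ᵇ-false : ∀ {k l} → k < l → (l ≡ᵇ k) ≡ false
<⇒≡ᵇ-false {k} {l} k<l = dec-false (l ℕ.≟ k) (<⇒≢ k<l ∘ sym)

-- Counting

count-cong : ∀ {n} {p q : Fin n → Bool} → (∀ x → p x ≡ q x) → count p ≡ count q
count-cong {zero}  p≗q = refl
count-cong {suc n} p≗q = cong₂ (λ b k → keepIf b 1 + k) (p≗q zero) (count-cong (p≗q ∘ suc))

count≡∑ : ∀ {n} (p : Fin n → Bool) → count p ≡ ∑[ y < n ] keepIf (p y) 1
count≡∑ {zero}  p = refl
count≡∑ {suc n} p = cong (keepIf (p zero) 1 +_) (count≡∑ (p ∘ suc))

count-false : ∀ n → count {n} (λ _ → false) ≡ 0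
count-false zero    = refl
count-false (suc n) = count-false n

count-≟ : ∀ {n} (a : Fin n) (p : Fin n → Bool) → count (λ y → ⌊ a ≟ y ⌋ ∧ p y) ≡ keepIf (p a) 1
count-≟ {suc n} zero    p = trans (cong (keepIf (p zero) 1 +_) (count-false n)) (+-identityʳ _)
count-≟ {suc n} (suc a) p =
  trans (count-cong (λ y → cong (_∧ p (suc y)) (⌊⌋-map′ (cong suc) _ (a ≟ y)))) (count-≟ a (p ∘ suc))

count-pos : ∀ {n} (p : Fin n → Bool) {a} → p a ≡ true → 0 < count p
count-pos p {zero}  pa rewrite pa = s≤s z≤n
count-pos p {suc a} pa = ≤-trans (count-pos (p ∘ suc) pa) (m≤n+m _ (keepIf (p zero) 1))

count-↑ : ∀ k {l} (p : Fin (k + l) → Bool) →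
          count p ≡ count (p ∘ (_↑ˡ l)) + count (p ∘ (k ↑ʳ_))
count-↑ zero    p = refl
count-↑ (suc k) p = trans (cong (keepIf (p zero) 1 +_) (count-↑ k (p ∘ suc))) (sym (+-assoc (keepIf (p zero) 1) _ _))

count-slice : ∀ {n m} (w : Fin m) (q : Fin (n * m) → Bool) (r : Fin n → Fin m → Bool) →
              (∀ a v → q (combine a v) ≡ ⌊ w ≟ v ⌋ ∧ r a v) → count q ≡ count (λ a → r a w)
count-slice {zero}      w q r q≡ = refl
count-slice {suc n} {m} w q r q≡ = trans (count-↑ m q) (cong₂ _+_
  (trans (count-cong (q≡ zero)) (count-≟ w (r zero)))
  (count-slice w (q ∘ (m ↑ʳ_)) (r ∘ suc) (q≡ ∘ suc)))

countFibre : ∀ {n k} → (Fin n → Bool) → (Fin n → Fin k) → Fin k → ℕ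
countFibre p f ρ = count (λ y → p y ∧ ⌊ f y ≟ ρ ⌋)

count-∘-fibres : ∀ {n k} (p : Fin n → Bool) (f : Fin n → Fin k) (g : Fin k → Bool) →
                 count (λ y → p y ∧ g (f y)) ≡ ∑[ ρ < k ] keepIf (g ρ) (countFibre p f ρ)
count-∘-fibres {zero}  {k} p f g = sym (trans (sum-cong-≗ (keepIf-0 ∘ g)) (sum-replicate-zero k))
count-∘-fibres {suc n} {k} p f g = begin
    keepIf (p 0F ∧ g (f 0F)) 1 + count (λ y → p (suc y) ∧ g (f (suc y)))
  ≡⟨ cong₂ _+_ head-term (count-∘-fibres (p ∘ suc) (f ∘ suc) g) ⟩
    ∑[ ρ < k ] here ρ + ∑[ ρ < k ] there ρ
  ≡⟨ ∑-distrib-+ here there ⟨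
    ∑[ ρ < k ] (here ρ + there ρ)
  ≡⟨ sum-cong-≗ (λ ρ → keepIf-+ (g ρ) _ _) ⟨
    ∑[ ρ < k ] keepIf (g ρ) (countFibre p f ρ)
  ∎
  where
  open ≡-Reasoning
  b = p 0F
  ρ₀ = f 0F
  here there : Fin k → ℕ
  here ρ = keepIf (g ρ) (keepIf (b ∧ ⌊ ρ₀ ≟ ρ ⌋) 1)
  there ρ = keepIf (g ρ) (countFibre (p ∘ suc) (f ∘ suc) ρ)
  -- the indicator of g ρ₀ counts the single ρ = ρ₀ at which g is tested
  head-term : keepIf (b ∧ g ρ₀) 1 ≡ ∑[ ρ < k ] here ρ
  head-term = begin
      keepIf (b ∧ g ρ₀) 1
    ≡⟨ sym (count-≟ ρ₀ (λ ρ → b ∧ g ρ)) ⟩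
      count (λ ρ → ⌊ ρ₀ ≟ ρ ⌋ ∧ (b ∧ g ρ))
    ≡⟨ count≡∑ (λ ρ → ⌊ ρ₀ ≟ ρ ⌋ ∧ (b ∧ g ρ)) ⟩
      ∑[ ρ < k ] keepIf (⌊ ρ₀ ≟ ρ ⌋ ∧ (b ∧ g ρ)) 1
    ≡⟨ sum-cong-≗ (λ ρ → trans (cong (λ x → keepIf x 1) (reorder ⌊ ρ₀ ≟ ρ ⌋ (g ρ)))
                              (sym (keepIf-∧ (g ρ) (b ∧ ⌊ ρ₀ ≟ ρ ⌋)))) ⟩
      ∑[ ρ < k ] here ρ
    ∎
    where
    reorder : ∀ d x → d ∧ (b ∧ x) ≡ (b ∧ d) ∧ x
    reorder d x = trans (sym (∧-assoc d b x)) (cong (_∧ x) (∧-comm d b))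

count-by-fibres : ∀ {n k} (p : Fin n → Bool) (f : Fin n → Fin k) →
                  count p ≡ ∑[ ρ < k ] countFibre p f ρ
count-by-fibres p f =
  trans (count-cong (λ y → sym (∧-identityʳ (p y)))) (count-∘-fibres p f (λ _ → true))

adjIndex : Bool → Fin 3
adjIndex b = if b then 1F else 2F

relIndex-refl : ∀ {n} (A : Adj n) x → relIndex A x x ≡ 0F
relIndex-refl A x with x ≟ x
... | yes _   = refl
... | no x≢x = ⊥-elim (x≢x refl)

relIndex-≢ : ∀ {n} (A : Adj n) {x y} → ¬ x ≡ y → relIndex A x y ≡ adjIndex (A x y)
relIndex-≢ A {x} {y} x≢y with x ≟ y
... | yes x≡y = ⊥-elim (x≢y x≡y)
... | no _    = refl

relIndex-sym : ∀ {n} {A : Adj n} → IsSimple A → ∀ x y → relIndex A x y ≡ relIndex A y x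
relIndex-sym {A = A} simple x y with x ≟ y | y ≟ x
... | yes _   | yes _   = refl
... | no _    | no _    = cong adjIndex (IsSimple.symmetric simple x y)
... | yes x≡y | no y≢x = ⊥-elim (y≢x (sym x≡y))
... | no x≢y  | yes y≡x = ⊥-elim (x≢y (sym y≡x))

countFibre-relIndex-0F : ∀ {n} (A : Adj n) (p : Fin n → Bool) a →
                         countFibre p (relIndex A a) 0F ≡ keepIf (p a) 1
countFibre-relIndex-0F A p a = trans (count-cong diagonal) (count-≟ a p)
  where
  diagonal : ∀ y → p y ∧ ⌊ relIndex A a y ≟ 0F ⌋ ≡ ⌊ a ≟ y ⌋ ∧ p y
  diagonal y with a ≟ y
  ... | yes _ = ∧-identityʳ (p y)
  ... | no _ with A a y
  ...   | true  = ∧-zeroʳ (p y)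
  ...   | false = ∧-zeroʳ (p y)

countFibre-relIndex-1F : ∀ {n} {A : Adj n} → IsSimple A → ∀ (p : Fin n → Bool) a →
                         countFibre p (relIndex A a) 1F ≡ count (λ y → p y ∧ A a y)
countFibre-relIndex-1F {A = A} simple p a = count-cong (λ y → cong (p y ∧_) (adjacent y))
  where
  adjacent : ∀ y → ⌊ relIndex A a y ≟ 1F ⌋ ≡ A a y
  adjacent y with a ≟ y
  ... | yes refl = sym (IsSimple.irreflexive simple a)
  ... | no _ with A a y
  ...   | true  = refl
  ...   | false = refl

inCell-just : ∀ {n t} (c : Labelling n t) {x j} i → c x ≡ just j → inCell c i x ≡ ⌊ j ≟ i ⌋
inCell-just c {x} i cx≡j with c x
inCell-just c i refl | just _ = refl

inCell-nothing : ∀ {n t} (c : Labelling n t) {x} i → c x ≡ nothing → inCell c i x ≡ false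
inCell-nothing c {x} i cx≡∅ with c x
inCell-nothing c i refl | nothing = refl

module _ {n t} (A : Adj n) (c : Labelling n t) where

  halfPair-refl : ∀ x → halfPair A c x x ≡ false
  halfPair-refl x with c x
  ... | just _  = refl
  ... | nothing = refl

  halfPair-just : ∀ {x y i} → c x ≡ just i → halfPair A c x y ≡ false
  halfPair-just {x} {y} cx with c x | c y
  halfPair-just refl | just _ | just _  = refl
  halfPair-just refl | just _ | nothing = refl

  halfPair-nothing-just : ∀ {x y i} → c x ≡ nothing → c y ≡ just i →
                          halfPair A c x y ≡ (2 * nbrs A c x i ≡ᵇ cellSize c i)
  halfPair-nothing-just {x} {y} cx cy with c x | c y
  halfPair-nothing-just refl refl | nothing | just _ = refl

  halfPair-nothingʳ : ∀ {x y} → c y ≡ nothing → halfPair A c x y ≡ false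
  halfPair-nothingʳ {x} {y} cy with c x | c y
  halfPair-nothingʳ refl | just _  | nothing = refl
  halfPair-nothingʳ refl | nothing | nothing = refl

-- Godsil–McKay arithmetic

GMCount : ℕ → ℕ → Set
GMCount k S = k ≡ 0 ⊎ (2 * k ≡ S ⊎ k ≡ S)

-- The K neighbours and R non-neighbours of a vertex of D inside a cell of size S.
data GMSplit : ℕ → ℕ → ℕ → Set where
  none : ∀ S → GMSplit 0 S S
  half : ∀ h → GMSplit h h (2 * h)
  all  : ∀ S → GMSplit S 0 S

gmSplit : ∀ {K R S} → K + R ≡ S → GMCount K S → GMSplit K R S
gmSplit R≡S (inj₁ refl) rewrite R≡S = none _
gmSplit {K} {R} K+R≡2K (inj₂ (inj₁ refl))
  with trans (+-cancelˡ-≡ K R (K + 0) K+R≡2K) (+-identityʳ K)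
... | refl = half K
gmSplit {K} {R} K+R≡K (inj₂ (inj₂ refl))
  with +-cancelˡ-≡ K R 0 (trans K+R≡K (sym (+-identityʳ K)))
... | refl = all K

gmCount-keepIf : ∀ g₁ g₂ {K R S} → GMSplit K R S → GMCount (keepIf g₁ K + keepIf g₂ R) S
gmCount-keepIf g₁ g₂ (none S) rewrite keepIf-0 g₁ with g₂
... | true  = inj₂ (inj₂ refl)
... | false = inj₁ refl
gmCount-keepIf g₁ g₂ (all S) rewrite keepIf-0 g₂ | +-identityʳ (keepIf g₁ S) with g₁
... | true  = inj₂ (inj₂ refl)
... | false = inj₁ refl
gmCount-keepIf true  true  (half h) = inj₂ (inj₂ (cong (h +_) (sym (+-identityʳ h))))
gmCount-keepIf true  false (half h) = inj₂ (inj₁ (cong (2 *_) (+-identityʳ h)))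
gmCount-keepIf false true  (half h) = inj₂ (inj₁ refl)
gmCount-keepIf false false (half h) = inj₁ refl

-- Only the half case is switched, and then only when the two weights differ.
halfTest-keepIf : ∀ g₁ g₂ {K R S} → GMSplit K R S → 0 < S →
                  (2 * (keepIf g₁ K + keepIf g₂ R) ≡ᵇ S) ≡ (2 * K ≡ᵇ S) ∧ (g₁ xor g₂)
halfTest-keepIf g₁ g₂ (none (suc S)) _ rewrite keepIf-0 g₁ with g₂
... | true  = <⇒≡ᵇ-false (m<m+n (suc S) (s≤s z≤n))
... | false = refl
halfTest-keepIf true g₂ (all (suc S)) _ = begin
    2 * (suc S + keepIf g₂ 0) ≡ᵇ suc S  ≡⟨ cong (λ x → 2 * x ≡ᵇ suc S) (trans (cong (suc S +_) (keepIf-0 g₂)) (+-identityʳ _)) ⟩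
    2 * suc S ≡ᵇ suc S                  ≡⟨ 2S≢S ⟩
    false                               ≡⟨ cong (_∧ not g₂) 2S≢S ⟨
    (2 * suc S ≡ᵇ suc S) ∧ not g₂       ∎
  where
  open ≡-Reasoning
  2S≢S = <⇒≡ᵇ-false (m<m+n (suc S) (s≤s z≤n))
halfTest-keepIf false g₂ (all (suc S)) _ =
  trans (cong (λ x → 2 * x ≡ᵇ suc S) (keepIf-0 g₂)) (sym (cong (_∧ g₂) (<⇒≡ᵇ-false (m<m+n (suc S) (s≤s z≤n)))))
halfTest-keepIf g₁ g₂ (half (suc h)) _ = trans (weights g₁ g₂) (sym (cong (_∧ (g₁ xor g₂)) (≡ᵇ-refl (2 * suc h))))
  where
  weights : ∀ g₁ g₂ → (2 * (keepIf g₁ (suc h) + keepIf g₂ (suc h)) ≡ᵇ 2 * suc h) ≡ g₁ xor g₂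
  weights true  true  = <⇒≡ᵇ-false (*-monoʳ-< 2 (m<m+n (suc h) (s≤s z≤n)))
  weights true  false = trans (cong (λ x → 2 * x ≡ᵇ 2 * suc h) (+-identityʳ (suc h))) (≡ᵇ-refl (2 * suc h))
  weights false true  = ≡ᵇ-refl (2 * suc h)
  weights false false = refl

toggle-adjIndex : ∀ (g : Fin 3 → Bool) h γ →
                  g (adjIndex (if h then not γ else γ))
                  ≡ (if h ∧ (g 1F xor g 2F) then not (g (adjIndex γ)) else g (adjIndex γ))
toggle-adjIndex g false γ = refl
toggle-adjIndex g true true  = recoverʳ (g 1F) (g 2F)
  where
  recoverʳ : ∀ x y → y ≡ (if x xor y then not x else x)
  recoverʳ true  true  = refl
  recoverʳ true  false = refl
  recoverʳ false true  = refl
  recoverʳ false false = refl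
toggle-adjIndex g true false = recoverˡ (g 1F) (g 2F)
  where
  recoverˡ : ∀ x y → x ≡ (if x xor y then not y else y)
  recoverˡ true  true  = refl
  recoverˡ true  false = refl
  recoverˡ false true  = refl
  recoverˡ false false = refl

∀-combine : ∀ {n m} (Q : Fin (n * m) → Set) → (∀ a b → Q (combine a b)) → ∀ x → Q x
∀-combine {n} {m} Q h x =
  subst Q (combine-remQuot {n} m x) (h (proj₁ (remQuot {n} m x)) (proj₂ (remQuot {n} m x)))

≟-combine : ∀ {n m} (i j : Fin n) (v w : Fin m) →
            ⌊ combine i v ≟ combine j w ⌋ ≡ ⌊ i ≟ j ⌋ ∧ ⌊ w ≟ v ⌋
≟-combine i j v w with i ≟ j | w ≟ v
... | yes refl | yes refl = ⌊⌋-yes (combine i v ≟ combine i v) refl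
... | yes refl | no w≢v  = ⌊⌋-no (combine i v ≟ combine i w) (w≢v ∘ sym ∘ combine-injectiveʳ i v i w)
... | no i≢j   | _        = ⌊⌋-no (combine i v ≟ combine j w) (i≢j ∘ combine-injectiveˡ i v j w)

quotRem-combine : ∀ {n m} (a : Fin n) (b : Fin m) → quotRem {n} m (combine a b) ≡ (b , a)
quotRem-combine {n} {m} a b = cong swap (remQuot-combine {n} {m} a b)

product-combine : ∀ {n m} (s : ProductType) (A : Adj n) (B : Adj m) a b a' b' →
                  product s A B (combine a b) (combine a' b') ≡ s (relIndex A a a') (relIndex B b b')
product-combine {n} {m} s A B a b a' b'
  with quotRem {n} m (combine a b)   | quotRem-combine a b
     | quotRem {n} m (combine a' b') | quotRem-combine a' b'
... | _ | refl | _ | refl = refl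

module _ {n t} (m : ℕ) (c : Labelling n t) where

  liftLabelling-combine : ∀ a b → liftLabelling m c (combine a b) ≡ Maybe.map (λ i → combine i b) (c a)
  liftLabelling-combine a b with quotRem {n} m (combine a b) | quotRem-combine a b
  ... | _ | refl with c a
  ...   | just _  = refl
  ...   | nothing = refl

  liftLabelling-just : ∀ {a i} b → c a ≡ just i → liftLabelling m c (combine a b) ≡ just (combine i b)
  liftLabelling-just {a} b ca = trans (liftLabelling-combine a b) (cong (Maybe.map (λ i → combine i b)) ca)

  liftLabelling-nothing : ∀ {a} b → c a ≡ nothing → liftLabelling m c (combine a b) ≡ nothing
  liftLabelling-nothing {a} b ca = trans (liftLabelling-combine a b) (cong (Maybe.map (λ i → combine i b)) ca)

  liftLabelling-just⁻¹ : ∀ a b {I} → liftLabelling m c (combine a b) ≡ just I →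
                         Σ (Fin t) λ i → c a ≡ just i × combine i b ≡ I
  liftLabelling-just⁻¹ a b L≡I with c a | liftLabelling-combine a b
  ... | just i  | L≡i = i , refl , just-injective (trans (sym L≡i) L≡I)
  ... | nothing | L≡∅ with trans (sym L≡∅) L≡I
  ...   | ()

  liftLabelling-nothing⁻¹ : ∀ a b → liftLabelling m c (combine a b) ≡ nothing → c a ≡ nothing
  liftLabelling-nothing⁻¹ a b L≡∅ with c a | liftLabelling-combine a b
  ... | nothing | _   = refl
  ... | just _  | L≡i with trans (sym L≡i) L≡∅
  ...   | ()

  inCell-lift : ∀ j w a v → inCell (liftLabelling m c) (combine j w) (combine a v) ≡ inCell c j a ∧ ⌊ w ≟ v ⌋
  inCell-lift j w a v with c a in ca
  ... | just i  = trans (inCell-just (liftLabelling m c) _ (liftLabelling-just v ca)) (≟-combine i j v w)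
  ... | nothing = inCell-nothing (liftLabelling m c) _ (liftLabelling-nothing v ca)

  cellSize-lift : ∀ j w → cellSize (liftLabelling m c) (combine j w) ≡ cellSize c j
  cellSize-lift j w = count-slice w _ (λ a _ → inCell c j a)
    (λ a v → trans (inCell-lift j w a v) (∧-comm (inCell c j a) ⌊ w ≟ v ⌋))

-- The Godsil–McKay partition of a product

module _ {n m t} (Γ : Adj n) (Δ : Adj m) (c : Labelling n t) (s : ProductType) where

  private
    P = product s Γ Δ
    L = liftLabelling m c

  -- the numbers of vertices of C j equal to, adjacent to and non-adjacent to a
  profile : Fin n → Fin t → Fin 3 → ℕ
  profile a j = countFibre (inCell c j) (relIndex Γ a)

  nbrs-product : ∀ a b j w →
                 nbrs P L (combine a b) (combine j w) ≡ ∑[ ρ < 3 ] keepIf (s ρ (relIndex Δ b w)) (profile a j ρ)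
  nbrs-product a b j w =
    trans (count-slice w _ (λ y v → inCell c j y ∧ s (relIndex Γ a y) (relIndex Δ b v)) slice)
          (count-∘-fibres (inCell c j) (relIndex Γ a) (λ ρ → s ρ (relIndex Δ b w)))
    where
    slice : ∀ y v → inCell L (combine j w) (combine y v) ∧ P (combine a b) (combine y v)
                    ≡ ⌊ w ≟ v ⌋ ∧ (inCell c j y ∧ s (relIndex Γ a y) (relIndex Δ b v))
    slice y v rewrite inCell-lift m c j w y v | product-combine s Γ Δ a b y v =
      trans (cong (_∧ _) (∧-comm (inCell c j y) ⌊ w ≟ v ⌋)) (∧-assoc ⌊ w ≟ v ⌋ _ _)

  profile-sum : ∀ a j → profile a j 0F + (profile a j 1F + profile a j 2F) ≡ cellSize c j
  profile-sum a j = trans (cong (λ x → profile a j 0F + (profile a j 1F + x)) (sym (+-identityʳ _)))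
                          (sym (count-by-fibres (inCell c j) (relIndex Γ a)))

  module _ (simple : IsSimple Γ) (gm : IsGMPartition Γ c) where

    profile-cell : ∀ {a a' i} → c a ≡ just i → c a' ≡ just i → ∀ j ρ → profile a j ρ ≡ profile a' j ρ
    profile-cell {a} {a'} {i} ca ca' j = same
      where
      same₀ : profile a j 0F ≡ profile a' j 0F
      same₀ = begin
          profile a j 0F                ≡⟨ countFibre-relIndex-0F Γ (inCell c j) a ⟩
          keepIf (inCell c j a) 1       ≡⟨ cong (λ x → keepIf x 1) (inCell-just c j ca) ⟩
          keepIf ⌊ i ≟ j ⌋ 1            ≡⟨ cong (λ x → keepIf x 1) (inCell-just c j ca') ⟨
          keepIf (inCell c j a') 1      ≡⟨ countFibre-relIndex-0F Γ (inCell c j) a' ⟨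
          profile a' j 0F               ∎
        where open ≡-Reasoning
      same₁ : profile a j 1F ≡ profile a' j 1F
      same₁ = trans (countFibre-relIndex-1F simple (inCell c j) a)
             (trans (IsGMPartition.equitable gm i j a a' ca ca')
                    (sym (countFibre-relIndex-1F simple (inCell c j) a')))
      same₂ : profile a j 2F ≡ profile a' j 2F
      same₂ = +-cancelˡ-≡ (profile a j 1F) _ _ (+-cancelˡ-≡ (profile a j 0F) _ _
        (trans (profile-sum a j) (trans (sym (profile-sum a' j))
          (sym (cong₂ (λ x y → x + (y + profile a' j 2F)) same₀ same₁)))))
      same : ∀ ρ → profile a j ρ ≡ profile a' j ρ
      same 0F = same₀
      same 1F = same₁
      same 2F = same₂

    module _ {a} (ca : c a ≡ nothing) (j : Fin t) where

      profile-D-0F : profile a j 0F ≡ 0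
      profile-D-0F = trans (countFibre-relIndex-0F Γ (inCell c j) a)
                           (cong (λ x → keepIf x 1) (inCell-nothing c j ca))

      profile-D-1F : profile a j 1F ≡ nbrs Γ c a j
      profile-D-1F = countFibre-relIndex-1F simple (inCell c j) a

      profile-D-split : GMSplit (profile a j 1F) (profile a j 2F) (cellSize c j)
      profile-D-split = gmSplit
        (subst (λ x → x + (profile a j 1F + profile a j 2F) ≡ cellSize c j) profile-D-0F (profile-sum a j))
        (subst (λ k → GMCount k (cellSize c j)) (sym profile-D-1F) (IsGMPartition.gmCell gm a ca j))

      nbrs-product-D : ∀ b w → let g = λ ρ → s ρ (relIndex Δ b w) in
                       nbrs P L (combine a b) (combine j w)
                       ≡ keepIf (g 1F) (profile a j 1F) + keepIf (g 2F) (profile a j 2F)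
      nbrs-product-D b w = begin
          nbrs P L (combine a b) (combine j w)
        ≡⟨ nbrs-product a b j w ⟩
          keepIf (g 0F) (profile a j 0F) + (keepIf (g 1F) K + (keepIf (g 2F) R + 0))
        ≡⟨ cong₂ (λ x y → keepIf (g 0F) x + (keepIf (g 1F) K + y)) profile-D-0F (+-identityʳ _) ⟩
          keepIf (g 0F) 0 + (keepIf (g 1F) K + keepIf (g 2F) R)
        ≡⟨ cong (_+ (keepIf (g 1F) K + keepIf (g 2F) R)) (keepIf-0 (g 0F)) ⟩
          keepIf (g 1F) K + keepIf (g 2F) R
        ∎
        where
        open ≡-Reasoning
        g = λ ρ → s ρ (relIndex Δ b w)
        K = profile a j 1F
        R = profile a j 2F

    equitable-product : ∀ I J x y → L x ≡ just I → L y ≡ just I → nbrs P L x J ≡ nbrs P L y J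
    equitable-product I J = ∀-combine _ λ a b → ∀-combine _ λ a' b' Lx Ly → go a b a' b' Lx Ly
      where
      go : ∀ a b a' b' → L (combine a b) ≡ just I → L (combine a' b') ≡ just I →
           nbrs P L (combine a b) J ≡ nbrs P L (combine a' b') J
      go a b a' b' Lx Ly
        with liftLabelling-just⁻¹ m c a b Lx | liftLabelling-just⁻¹ m c a' b' Ly
      ... | i , ca , refl | i' , ca' , ii'
        with combine-injectiveˡ i' b' i b ii' | combine-injectiveʳ i' b' i b ii'
      ... | refl | refl = ∀-combine _ (λ j w →
        trans (nbrs-product a b j w)
              (trans (sum-cong-≗ (λ ρ → cong (keepIf (s ρ (relIndex Δ b w))) (profile-cell ca ca' j ρ)))
                     (sym (nbrs-product a' b j w)))) J

    gmCell-product : ∀ x → L x ≡ nothing → ∀ I → GMCount (nbrs P L x I) (cellSize L I)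
    gmCell-product = ∀-combine _ λ a b Lx → ∀-combine _ λ j w →
      let ca = liftLabelling-nothing⁻¹ m c a b Lx in
      subst₂ GMCount (sym (nbrs-product-D ca j b w)) (sym (cellSize-lift m c j w))
             (gmCount-keepIf (s 1F (relIndex Δ b w)) (s 2F (relIndex Δ b w)) (profile-D-split ca j))

    product-isGMPartition : IsGMPartition P L
    product-isGMPartition = record { equitable = equitable-product ; gmCell = gmCell-product }

    module _ (simpleΔ : IsSimple Δ) where

      halfPair-product : ∀ a b a' b' → let r = relIndex Δ b b' in
                         halfPair P L (combine a b) (combine a' b') ≡ halfPair Γ c a a' ∧ (s 1F r xor s 2F r)
      halfPair-product a b a' b' with c a in ca | c a' in ca'
      ... | just _  | _       = halfPair-just P L (liftLabelling-just m c b ca)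
      ... | nothing | nothing = halfPair-nothingʳ P L (liftLabelling-nothing m c b' ca')
      ... | nothing | just j  = begin
          halfPair P L (combine a b) (combine a' b')
        ≡⟨ halfPair-nothing-just P L (liftLabelling-nothing m c b ca) (liftLabelling-just m c b' ca') ⟩
          2 * nbrs P L (combine a b) (combine j b') ≡ᵇ cellSize L (combine j b')
        ≡⟨ cong₂ (λ N S → 2 * N ≡ᵇ S) (nbrs-product-D ca j b b') (cellSize-lift m c j b') ⟩
          2 * (keepIf (g 1F) K + keepIf (g 2F) R) ≡ᵇ cellSize c j
        ≡⟨ halfTest-keepIf (g 1F) (g 2F) (profile-D-split ca j) (count-pos (inCell c j) a'∈Cj) ⟩
          (2 * K ≡ᵇ cellSize c j) ∧ (g 1F xor g 2F)
        ≡⟨ cong (λ k → (2 * k ≡ᵇ cellSize c j) ∧ (g 1F xor g 2F)) (profile-D-1F ca j) ⟩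
          (2 * nbrs Γ c a j ≡ᵇ cellSize c j) ∧ (g 1F xor g 2F)
        ∎
        where
        open ≡-Reasoning
        g = λ ρ → s ρ (relIndex Δ b b')
        K = profile a j 1F
        R = profile a j 2F
        a'∈Cj : inCell c j a' ≡ true
        a'∈Cj = trans (inCell-just c j ca') (⌊⌋-yes (j ≟ j) refl)

      -- Switching acts on unordered pairs; both orientations carry the same Δ-weight as Δ is symmetric.
      switchFlag-product : ∀ a b a' b' → let r = relIndex Δ b b' in
        halfPair P L (combine a b) (combine a' b') ∨ halfPair P L (combine a' b') (combine a b)
        ≡ (halfPair Γ c a a' ∨ halfPair Γ c a' a) ∧ (s 1F r xor s 2F r)
      switchFlag-product a b a' b' = trans
        (cong₂ _∨_ (halfPair-product a b a' b')
                   (trans (halfPair-product a' b' a b)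
                          (cong (λ ρ → halfPair Γ c a' a ∧ (s 1F ρ xor s 2F ρ)) (relIndex-sym simpleΔ b' b))))
        (sym (∧-distribʳ-∨ _ (halfPair Γ c a a') (halfPair Γ c a' a)))

      switch-product-combine : ∀ a b a' b' →
        product s (switch Γ c) Δ (combine a b) (combine a' b') ≡ switch P L (combine a b) (combine a' b')
      switch-product-combine a b a' b' with a ≟ a'
      ... | yes refl = begin
          product s (switch Γ c) Δ X Y
        ≡⟨ product-combine s (switch Γ c) Δ a b a b' ⟩
          s (relIndex (switch Γ c) a a) r
        ≡⟨ cong (λ ρ → s ρ r) (trans (relIndex-refl (switch Γ c) a) (sym (relIndex-refl Γ a))) ⟩
          s (relIndex Γ a a) r
        ≡⟨ product-combine s Γ Δ a b a b' ⟨
          P X Y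
        ≡⟨ cong (λ h → if h then not (P X Y) else P X Y) flag≡false ⟨
          switch P L X Y
        ∎
        where
        open ≡-Reasoning
        X = combine a b
        Y = combine a b'
        r = relIndex Δ b b'
        flag≡false : halfPair P L X Y ∨ halfPair P L Y X ≡ false
        flag≡false = trans (switchFlag-product a b a b')
          (cong (_∧ (s 1F r xor s 2F r)) (cong₂ _∨_ (halfPair-refl Γ c a) (halfPair-refl Γ c a)))
      ... | no a≢a' = begin
          product s (switch Γ c) Δ X Y
        ≡⟨ product-combine s (switch Γ c) Δ a b a' b' ⟩
          s (relIndex (switch Γ c) a a') r
        ≡⟨ cong (λ ρ → s ρ r) (relIndex-≢ (switch Γ c) a≢a') ⟩
          s (adjIndex (if h then not γ else γ)) r
        ≡⟨ toggle-adjIndex (λ ρ → s ρ r) h γ ⟩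
          (if h ∧ (s 1F r xor s 2F r) then not (s (adjIndex γ) r) else s (adjIndex γ) r)
        ≡⟨ cong₂ (λ h x → if h then not x else x) (switchFlag-product a b a' b') PXY ⟨
          switch P L X Y
        ∎
        where
        open ≡-Reasoning
        X = combine a b
        Y = combine a' b'
        r = relIndex Δ b b'
        h = halfPair Γ c a a' ∨ halfPair Γ c a' a
        γ = Γ a a'
        PXY : P X Y ≡ s (adjIndex γ) r
        PXY = trans (product-combine s Γ Δ a b a' b') (cong (λ ρ → s ρ r) (relIndex-≢ Γ a≢a'))

      switch-product : ∀ x y → product s (switch Γ c) Δ x y ≡ switch P L x y
      switch-product = ∀-combine _ λ a b → ∀-combine _ λ a' b' → switch-product-combine a b a' b'

theorem4p1 : ∀ {n m t : ℕ} (Γ : Adj n) (Δ : Adj m) (c : Labelling n t) (s : ProductType) →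
             IsSimple Γ → IsSimple Δ → IsGMPartition Γ c → s zero zero ≡ false →
             IsGMPartition (product s Γ Δ) (liftLabelling m c)
             × Isomorphic (product s (switch Γ c) Δ) (switch (product s Γ Δ) (liftLabelling m c))
theorem4p1 Γ Δ c s simpleΓ simpleΔ gm _ =
  product-isGMPartition Γ Δ c s simpleΓ gm ,
  (↔-id _ , switch-product Γ Δ c s simpleΓ gm simpleΔ)
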